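{- Let $\vec a,\vec b\in\mathcal C$ with $m:=\mathrm{lv}(\vec a)>\mathrm{lv}(\vec b)$. Then $\vec a+\vec b\preceq\vec a\Box\vec b$, i.e. $a_i+b_i\preceq(\vec a\Box\vec b)_i$ for all $i\le m$.
   Context: Ordinals: $\oplus,\otimes$ natural sum/product below $\varepsilon_0$; $2^\alpha:=\omega^{\alpha_0}2^k$ for $\alpha=\omega\alpha_0+k$; $\mathrm{no}(0)=0$, $\mathrm{no}(\omega^{\alpha_1}+\dots+\omega^{\alpha_k})=k+\sum_i\mathrm{no}(\alpha_i)$; $F_0(x)=2^x$, $F_{j+1}(x)=F_j^{x+1}(x)$, $\Phi(x)=F_5(x+100)$; $\psi(\alpha)=\max(\{0\}\cup\{\psi(\beta)+1:\beta<\alpha,\mathrm{no}(\beta)\le\Phi(\mathrm{no}(\alpha))\})$. Each typed variable $Y^\rho$ has a vector $\vec y=\langle y_0,\dots,y_{\mathrm{lv}(\rho)}\rangle$ of distinct ordinal variables (disjoint for distinct variables). Ordinal terms: ordinal variables, $0,1,\omega$, $f+g$, $2^f\cdot g$, $\psi(\omega f+g)$; closed terms denote ordinals ($+$ as $\oplus$, $\cdot$ as $\otimes$). Vectors $\langle h_0,\dots,h_n\rangle$ of level $n$, $h_i=0$ for $i>n$, sums componentwise. $\mathcal B_i$: $1\in\mathcal B_i$; $\omega\in\mathcal B_i$ ($i\ge1$); closed under $+$; $2^fg\in\mathcal B_i$ if $f\in\mathcal B_{i+1},g\in\mathcal B_i,i\ge1$; $\psi(\omega f+g)\in\mathcal B_0$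 if $f\in\mathcal B_1,g\in\mathcal B_0,\mathrm{no}(f)\le F_2(g)$; $\mathcal B_0\subseteq\mathcal B_i$. Closed $\vec f$ has bounded norm if $\mathrm{no}(f_i)\le\mathrm{no}(f_0)$. $f\prec g$ / $f\preceq g$: holds under every substitution $\chi$ of the variable vectors occurring by vectors with $\chi(x_i)\in\mathcal B_i$ of bounded norm. For vectors, $\vec f\preceq\vec g$ iff $f_i\preceq g_i$ for all $i$. $\mathcal C_i$: $1\in\mathcal C_i$; $\omega\in\mathcal C_i$ ($i\ge1$); $y^\rho_i\in\mathcal C_i$ for $i\le\mathrm{lv}(\rho)$; closed under $+$; $2^fg\in\mathcal C_i$ if $f\in\mathcal C_{i+1},g\in\mathcal C_i,i\ge1$; $\psi(\omega f+g)\in\mathcal C_0$ if $f\in\mathcal C_1,g\in\mathcal C_0,\mathrm{no}(f)\preceq F_2(g)$; $\mathcal C_0\subseteq\mathcal C_i$. $\mathcal C$: vectors with $h_i\in\mathcal C_i$. $\Box$: for $m=\mathrm{lv}(\vec f)>\mathrm{lv}(\vec g)=n$: $(\vec f\Box\vec g)_0=\psi(\omega(\vec f\Box\vec g)_1+f_0+g_0+n)$, $(\vec f\Box\vec g)_i=2^{(\vec f\Box\vec g)_{i+1}}(f_i+g_i)$ ($1\le i\le n$), $=f_i$ ($n<i\le m$). -}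

module Defs where

open import Data.Nat using (ℕ; zero; suc; _+_; _*_; _∸_; _^_; _≤_; _<_; _≤?_; _<?_; s≤s)
open import Data.Bool using (Bool; true; false; if_then_else_)
open import Data.Product using (_×_; Σ; ∃; _,_)
open import Data.Sum using (_⊎_)
open import Data.Fin using (Fin; toℕ; fromℕ<)
open import Relation.Nullary using (yes) renaming (no to no′)
open import Data.Vec using (Vec; lookup; tabulate; []; _∷_)
open import Function using (_∘_)
open import Relation.Binary.PropositionalEquality using (_≡_)

-- Ordinals below ε₀ in Cantor normal form (as raw trees + NF predicate)
-- ω^ a + b  represents  ω^a + b

data Ord : Set where
  𝟎     : Ord
  ω^_+_ : Ord → Ord → Ord

data Cmp : Set where
  lt eq gt : Cmp

cmp : Ord → Ord → Cmp
cmp 𝟎 𝟎 = eq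
cmp 𝟎 (ω^ _ + _) = lt
cmp (ω^ _ + _) 𝟎 = gt
cmp (ω^ a + b) (ω^ c + d) with cmp a c
... | lt = lt
... | gt = gt
... | eq = cmp b d

data _<ₒ_ : Ord → Ord → Set where
  <𝟎  : ∀ {a b} → 𝟎 <ₒ (ω^ a + b)
  <hd : ∀ {a b c d} → a <ₒ c → (ω^ a + b) <ₒ (ω^ c + d)
  <tl : ∀ {a b d} → b <ₒ d → (ω^ a + b) <ₒ (ω^ a + d)

_≤ₒ_ : Ord → Ord → Set
a ≤ₒ b = a <ₒ b ⊎ a ≡ b

data NF : Ord → Set where
  nf𝟎 : NF 𝟎
  nf1 : ∀ {a} → NF a → NF (ω^ a + 𝟎)
  nf2 : ∀ {a c d} → NF a → NF (ω^ c + d) → c ≤ₒ a → NF (ω^ a + (ω^ c + d))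

-- natural (Hessenberg) sum: merge of the CNF lists.
-- insω a b r y  merges  ω^a + b  with y, where r = (b ⊕_)
insω : Ord → Ord → (Ord → Ord) → Ord → Ord
insω a b r 𝟎 = ω^ a + b
insω a b r (ω^ c + d) with cmp a c
... | lt = ω^ c + insω a b r d
... | _  = ω^ a + r (ω^ c + d)

_⊕_ : Ord → Ord → Ord
𝟎 ⊕ y = y
(ω^ a + b) ⊕ y = insω a b (b ⊕_) y

mulω : Ord → Ord → Ord
mulω a 𝟎 = 𝟎
mulω a (ω^ c + d) = (ω^ (a ⊕ c) + 𝟎) ⊕ mulω a d

_⊗_ : Ord → Ord → Ord
𝟎 ⊗ y = 𝟎
(ω^ a + b) ⊗ y = mulω a y ⊕ (b ⊗ y)

fromℕ : ℕ → Ord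
fromℕ zero = 𝟎
fromℕ (suc n) = ω^ 𝟎 + fromℕ n

𝟏 ω : Ord
𝟏 = ω^ 𝟎 + 𝟎
ω = ω^ 𝟏 + 𝟎

-- finite part k of α = ω·α₀ + k  (number of summands ω^0)
finPart : Ord → ℕ
finPart 𝟎 = 0
finPart (ω^ 𝟎 + b) = suc (finPart b)
finPart (ω^ (ω^ _ + _) + b) = finPart b

isFinite : Ord → Bool
isFinite 𝟎 = true
isFinite (ω^ 𝟎 + b) = isFinite b
isFinite (ω^ (ω^ _ + _) + b) = false

-- for γ ≥ 1: the γ' with 1 + γ' = γ
predω : Ord → Ord
predω γ = if isFinite γ then fromℕ (finPart γ ∸ 1) else γ

-- α₀ with α = ω·α₀ + k
divω : Ord → Ord
divω 𝟎 = 𝟎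
divω (ω^ 𝟎 + b) = divω b
divω (ω^ (ω^ g + h) + b) = (ω^ predω (ω^ g + h) + 𝟎) ⊕ divω b

-- 2^α := ω^{α₀}·2^k  for α = ω·α₀ + k
pow2 : Ord → Ord
pow2 α = (ω^ divω α + 𝟎) ⊗ fromℕ (2 ^ finPart α)

no : Ord → ℕ
no 𝟎 = 0
no (ω^ a + b) = suc (no a + no b)

iter : (ℕ → ℕ) → ℕ → ℕ → ℕ
iter f zero x = x
iter f (suc k) x = f (iter f k x)

F : ℕ → ℕ → ℕ
F zero x = 2 ^ x
F (suc j) x = iter (F j) (suc x) x

Φ : ℕ → ℕ
Φ x = F 5 (x + 100)

-- ψ is characterised by its defining recursion:
-- ψ(α) = max({0} ∪ {ψ(β)+1 : β<α, no(β) ≤ Φ(no(α))})   (for α < ε₀ in NF)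
IsPsi : (Ord → ℕ) → Set
IsPsi ψ = ∀ α → NF α →
    (∀ β → NF β → β <ₒ α → no β ≤ Φ (no α) → suc (ψ β) ≤ ψ α)
  × (ψ α ≡ 0 ⊎ Σ Ord (λ β → NF β × β <ₒ α × no β ≤ Φ (no α) × ψ α ≡ suc (ψ β)))

-- Ordinal terms. var v i is the ordinal variable y_i of the typed variable
-- number v.  twoPow f g is 2^f·g,  psi f g is ψ(ω f + g).

data Term : Set where
  var    : ℕ → ℕ → Term
  zer    : Term
  one    : Term
  om     : Term
  plus   : Term → Term → Term
  twoPow : Term → Term → Term
  psi    : Term → Term → Term

num : ℕ → Term
num zero = zer
num (suc zero) = one
num (suc (suc n)) = plus (num (suc n)) one

Env : Set
Env = ℕ → ℕ → Ord

⟦_⟧ : Term → (Ord → ℕ) → Env → Ord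
⟦ var v i ⟧ ψ ρ = ρ v i
⟦ zer ⟧ ψ ρ = 𝟎
⟦ one ⟧ ψ ρ = 𝟏
⟦ om ⟧ ψ ρ = ω
⟦ plus f g ⟧ ψ ρ = ⟦ f ⟧ ψ ρ ⊕ ⟦ g ⟧ ψ ρ
⟦ twoPow f g ⟧ ψ ρ = pow2 (⟦ f ⟧ ψ ρ) ⊗ ⟦ g ⟧ ψ ρ
⟦ psi f g ⟧ ψ ρ = fromℕ (ψ ((ω ⊗ ⟦ f ⟧ ψ ρ) ⊕ ⟦ g ⟧ ψ ρ))

⟦_⟧c : Term → (Ord → ℕ) → Ord
⟦ t ⟧c ψ = ⟦ t ⟧ ψ (λ _ _ → 𝟎)

data B (ψ : Ord → ℕ) : ℕ → Term → Set where
  b1   : ∀ {i} → B ψ i one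
  bω   : ∀ {i} → 1 ≤ i → B ψ i om
  b+   : ∀ {i f g} → B ψ i f → B ψ i g → B ψ i (plus f g)
  b2   : ∀ {i f g} → 1 ≤ i → B ψ (suc i) f → B ψ i g → B ψ i (twoPow f g)
  bψ   : ∀ {f g} → B ψ 1 f → B ψ 0 g →
         no (⟦ f ⟧c ψ) ≤ F 2 (finPart (⟦ g ⟧c ψ)) → B ψ 0 (psi f g)
  b0   : ∀ {i f} → B ψ 0 f → B ψ i f

-- admissible substitutions: lv v is the level lv(ρ) of typed variable v;
-- χ v = ⟨χ v 0,…,χ v (lv v)⟩ with χ v i ∈ B_i, zero above the level,
-- of bounded norm.
Admissible : (Ord → ℕ) → (ℕ → ℕ) → (ℕ → ℕ → Term) → Set
Admissible ψ lv χ =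
    (∀ v i → i ≤ lv v → B ψ i (χ v i))
  × (∀ v i → lv v < i → χ v i ≡ zer)
  × (∀ v i → no (⟦ χ v i ⟧c ψ) ≤ no (⟦ χ v 0 ⟧c ψ))

envOf : (Ord → ℕ) → (ℕ → ℕ → Term) → Env
envOf ψ χ v i = ⟦ χ v i ⟧c ψ

_⊢_≼_ : (Ord → ℕ) × (ℕ → ℕ) → Term → Term → Set
(ψ , lv) ⊢ f ≼ g = ∀ χ → Admissible ψ lv χ → ⟦ f ⟧ ψ (envOf ψ χ) ≤ₒ ⟦ g ⟧ ψ (envOf ψ χ)

data C (ψ : Ord → ℕ) (lv : ℕ → ℕ) : ℕ → Term → Set where
  c1   : ∀ {i} → C ψ lv i one
  cω   : ∀ {i} → 1 ≤ i → C ψ lv i om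
  cvar : ∀ {v i} → i ≤ lv v → C ψ lv i (var v i)
  c+   : ∀ {i f g} → C ψ lv i f → C ψ lv i g → C ψ lv i (plus f g)
  c2   : ∀ {i f g} → 1 ≤ i → C ψ lv (suc i) f → C ψ lv i g → C ψ lv i (twoPow f g)
  cψ   : ∀ {f g} → C ψ lv 1 f → C ψ lv 0 g →
         (∀ χ → Admissible ψ lv χ →
            no (⟦ f ⟧ ψ (envOf ψ χ)) ≤ F 2 (finPart (⟦ g ⟧ ψ (envOf ψ χ)))) →
         C ψ lv 0 (psi f g)
  c0   : ∀ {i f} → C ψ lv 0 f → C ψ lv i f

-- Vectors of level n: Vec Term (suc n), components above n are 0.

get : ∀ {n} → Vec Term (suc n) → ℕ → Term
get {n} v i with i ≤? n
... | yes p = lookup v (fromℕ< (s≤s p))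
... | no′ _  = zer

InC : (Ord → ℕ) → (ℕ → ℕ) → ∀ {n} → Vec Term (suc n) → Set
InC ψ lv {n} v = (i : Fin (suc n)) → C ψ lv (toℕ i) (lookup v i)

-- (f □ g)_i computed top-down: boxAux i k with i + k = m
boxAux : ∀ {m n} → Vec Term (suc m) → Vec Term (suc n) → ℕ → ℕ → Term
boxAux {m} {n} f g i zero = get f i
boxAux {m} {n} f g zero (suc k) = psi (boxAux f g 1 k) (plus (plus (get f 0) (get g 0)) (num n))
boxAux {m} {n} f g (suc i) (suc k) with n <? suc i
... | yes _ = get f (suc i)
... | no′ _  =
  twoPow (boxAux f g (suc (suc i)) k) (plus (get f (suc i)) (get g (suc i)))

box : ∀ {m n} → Vec Term (suc m) → Vec Term (suc n) → Vec Term (suc m)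
box {m} f g = tabulate (λ i → boxAux f g (toℕ i) (m ∸ toℕ i))

-- Above lv(b) the box simply copies a,
-- while b contributes 0.  At 1 ≤ i ≤ lv(b) the component is 2^X·(aᵢ + bᵢ),
-- and multiplying by a nonzero ordinal never decreases a normal form.  At
-- i = 0 the component is the natural number ψ(α) with a₀ + b₀ a summand of α;
-- but a₀ + b₀ denotes a natural number r (level-0 terms are finite), and ψ(α)
-- is at least the finite part of α, since α can be decremented that many
-- times within the norm bound Φ(no α), each step increasing ψ by one.
module Submission where

open import Defs
open import Data.Nat using (ℕ; _≤_; _<_)
open import Data.Vec using (Vec)
open import Data.Product using (_,_)

open import Data.Nat using (zero; suc; _+_; _^_; _∸_; z≤n; s≤s; _≤?_; _<?_; NonZero)
open import Data.Nat.Properties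
  using ( ≤-refl; ≤-trans; ≤-<-trans; n≤1+n; m≤m+n; m≤n+m; +-mono-≤
        ; +-monoʳ-≤; +-identityʳ; +-assoc; +-commutativeSemigroup; suc-injective
        ; <⇒≱; ≮⇒≥; m^n>0; m^n≢0 )
open import Algebra.Properties.CommutativeSemigroup +-commutativeSemigroup
  using (x∙yz≈y∙xz)
open import Data.Product using (∃-syntax; proj₁)
open import Data.Sum using (inj₁; inj₂)
open import Data.Unit using (⊤; tt)
open import Data.Bool using (true; false)
open import Data.Fin using (toℕ; fromℕ<)
open import Data.Fin.Properties using (toℕ-fromℕ<)
open import Data.Vec using (lookup)
open import Data.Vec.Properties using (lookup∘tabulate)
open import Relation.Nullary using (yes; contradiction) renaming (no to no′)
open import Relation.Binary.Definitions using (Transitive; Trans)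
open import Relation.Binary.PropositionalEquality
  using (_≡_; refl; sym; trans; cong; subst; isEquivalence; resp₂; respˡ; respʳ)
import Relation.Binary.Construct.StrictToNonStrict _≡_ _<ₒ_ as NonStrict

<ₒ-trans : Transitive _<ₒ_
<ₒ-trans <𝟎 (<hd _) = <𝟎
<ₒ-trans <𝟎 (<tl _) = <𝟎
<ₒ-trans (<hd p) (<hd q) = <hd (<ₒ-trans p q)
<ₒ-trans (<hd p) (<tl _) = <hd p
<ₒ-trans (<tl _) (<hd q) = <hd q
<ₒ-trans (<tl p) (<tl q) = <tl (<ₒ-trans p q)

≤ₒ-trans : Transitive _≤ₒ_
≤ₒ-trans = NonStrict.trans isEquivalence (resp₂ _<ₒ_) <ₒ-trans

<-≤ₒ-trans : Trans _<ₒ_ _≤ₒ_ _<ₒ_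
<-≤ₒ-trans = NonStrict.<-≤-trans <ₒ-trans (respʳ _<ₒ_)

≤-<ₒ-trans : Trans _≤ₒ_ _<ₒ_ _<ₒ_
≤-<ₒ-trans = NonStrict.≤-<-trans sym <ₒ-trans (respˡ _<ₒ_)

𝟎≤ₒ : ∀ x → 𝟎 ≤ₒ x
𝟎≤ₒ 𝟎 = inj₂ refl
𝟎≤ₒ (ω^ _ + _) = inj₁ <𝟎

ω^+-monoʳ-≤ₒ : ∀ {a b d} → b ≤ₒ d → (ω^ a + b) ≤ₒ (ω^ a + d)
ω^+-monoʳ-≤ₒ (inj₁ b<d) = inj₁ (<tl b<d)
ω^+-monoʳ-≤ₒ (inj₂ refl) = inj₂ refl

data CmpView (a c : Ord) : Cmp → Set where
  lt : a <ₒ c → CmpView a c lt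
  eq : a ≡ c → CmpView a c eq
  gt : c <ₒ a → CmpView a c gt

cmp-view : ∀ a c → CmpView a c (cmp a c)
cmp-view 𝟎 𝟎 = eq refl
cmp-view 𝟎 (ω^ _ + _) = lt <𝟎
cmp-view (ω^ _ + _) 𝟎 = gt <𝟎
cmp-view (ω^ a + b) (ω^ c + d) with cmp a c | cmp-view a c
... | lt | lt p = lt (<hd p)
... | gt | gt p = gt (<hd p)
... | eq | eq refl with cmp b d | cmp-view b d
...   | lt | lt p = lt (<tl p)
...   | eq | eq refl = eq refl
...   | gt | gt p = gt (<tl p)

-- All exponents of x are ≤ e, i.e. x < ω^(e+1), provided x is in normal form.
LeadExp≤ : Ord → Ord → Set
LeadExp≤ e 𝟎 = ⊤
LeadExp≤ e (ω^ c + _) = c ≤ₒ e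

NF-leadExp : ∀ {a b} → NF (ω^ a + b) → LeadExp≤ a b
NF-leadExp (nf1 _) = tt
NF-leadExp (nf2 _ _ c≤a) = c≤a

NF-head : ∀ {a b} → NF (ω^ a + b) → NF a
NF-head (nf1 na) = na
NF-head (nf2 na _ _) = na

NF-tail : ∀ {a b} → NF (ω^ a + b) → NF b
NF-tail (nf1 _) = nf𝟎
NF-tail (nf2 _ nb _) = nb

NF-ω^+ : ∀ {a b} → NF a → NF b → LeadExp≤ a b → NF (ω^ a + b)
NF-ω^+ na nf𝟎 _ = nf1 na
NF-ω^+ na nb@(nf1 _) c≤a = nf2 na nb c≤a
NF-ω^+ na nb@(nf2 _ _ _) c≤a = nf2 na nb c≤a

leadExp≤-weaken : ∀ {c e} x → LeadExp≤ c x → c ≤ₒ e → LeadExp≤ e x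
leadExp≤-weaken 𝟎 _ _ = tt
leadExp≤-weaken (ω^ _ + _) d≤c c≤e = ≤ₒ-trans d≤c c≤e

leadExp≤-⊕ : ∀ {e} x y → LeadExp≤ e x → LeadExp≤ e y → LeadExp≤ e (x ⊕ y)
leadExp≤-⊕ 𝟎 y _ hy = hy
leadExp≤-⊕ (ω^ a + b) 𝟎 hx _ = hx
leadExp≤-⊕ (ω^ a + b) (ω^ c + d) hx hy with cmp a c
... | lt = hy
... | eq = hx
... | gt = hx

⊕-NF : ∀ x y → NF x → NF y → NF (x ⊕ y)
⊕-NF 𝟎 y _ ny = ny
⊕-NF (ω^ a + b) y nx ny = insω-NF (λ y′ → ⊕-NF b y′ (NF-tail nx)) y ny
  where
  insω-NF : (∀ y → NF y → NF (b ⊕ y)) → ∀ y → NF y → NF ((ω^ a + b) ⊕ y)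
  insω-NF ih 𝟎 _ = nx
  insω-NF ih (ω^ c + d) ny with cmp a c | cmp-view a c
  ... | lt | lt a<c = NF-ω^+ (NF-head ny) (insω-NF ih d (NF-tail ny))
                        (leadExp≤-⊕ (ω^ a + b) d (inj₁ a<c) (NF-leadExp ny))
  ... | eq | eq a≡c = NF-ω^+ (NF-head nx) (ih (ω^ c + d) ny)
                        (leadExp≤-⊕ b (ω^ c + d) (NF-leadExp nx) (inj₂ (sym a≡c)))
  ... | gt | gt c<a = NF-ω^+ (NF-head nx) (ih (ω^ c + d) ny)
                        (leadExp≤-⊕ b (ω^ c + d) (NF-leadExp nx) (inj₁ c<a))

mulω-NF : ∀ a y → NF a → NF y → NF (mulω a y)
mulω-NF a 𝟎 _ _ = nf𝟎
mulω-NF a (ω^ c + d) na ny =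
  ⊕-NF _ _ (nf1 (⊕-NF a c na (NF-head ny))) (mulω-NF a d na (NF-tail ny))

⊗-NF : ∀ x y → NF x → NF y → NF (x ⊗ y)
⊗-NF 𝟎 _ _ _ = nf𝟎
⊗-NF (ω^ a + b) y nx ny = ⊕-NF _ _ (mulω-NF a y (NF-head nx) ny) (⊗-NF b y (NF-tail nx) ny)

fromℕ-NF : ∀ n → NF (fromℕ n)
fromℕ-NF zero = nf𝟎
fromℕ-NF (suc zero) = nf1 nf𝟎
fromℕ-NF (suc (suc n)) = nf2 nf𝟎 (fromℕ-NF (suc n)) (inj₂ refl)

ω-NF : NF ω
ω-NF = nf1 (nf1 nf𝟎)

predω-NF : ∀ γ → NF γ → NF (predω γ)
predω-NF γ nγ with isFinite γ
... | true = fromℕ-NF _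
... | false = nγ

divω-NF : ∀ γ → NF γ → NF (divω γ)
divω-NF 𝟎 _ = nf𝟎
divω-NF (ω^ 𝟎 + b) nγ = divω-NF b (NF-tail nγ)
divω-NF (ω^ (ω^ _ + _) + b) nγ =
  ⊕-NF _ _ (nf1 (predω-NF _ (NF-head nγ))) (divω-NF b (NF-tail nγ))

pow2-NF : ∀ α → NF α → NF (pow2 α)
pow2-NF α nα = ⊗-NF _ _ (nf1 (divω-NF α nα)) (fromℕ-NF (2 ^ finPart α))

⟦⟧-NF : ∀ {ψ ρ} → (∀ v i → NF (ρ v i)) → ∀ t → NF (⟦ t ⟧ ψ ρ)
⟦⟧-NF nρ (var v i) = nρ v i
⟦⟧-NF nρ zer = nf𝟎
⟦⟧-NF nρ one = nf1 nf𝟎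
⟦⟧-NF nρ om = ω-NF
⟦⟧-NF nρ (plus f g) = ⊕-NF _ _ (⟦⟧-NF nρ f) (⟦⟧-NF nρ g)
⟦⟧-NF nρ (twoPow f g) = ⊗-NF _ _ (pow2-NF _ (⟦⟧-NF nρ f)) (⟦⟧-NF nρ g)
⟦⟧-NF nρ (psi f g) = fromℕ-NF _

envOf-NF : ∀ ψ χ v i → NF (envOf ψ χ v i)
envOf-NF ψ χ v i = ⟦⟧-NF (λ _ _ → nf𝟎) (χ v i)

⊕-identityʳ : ∀ x → x ⊕ 𝟎 ≡ x
⊕-identityʳ 𝟎 = refl
⊕-identityʳ (ω^ _ + _) = refl

q<ω^p+q : ∀ {p q} → NF (ω^ p + q) → q <ₒ (ω^ p + q)
q<ω^p+q (nf1 _) = <𝟎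
q<ω^p+q (nf2 _ _ (inj₁ c<a)) = <hd c<a
q<ω^p+q (nf2 _ nq (inj₂ refl)) = <tl (q<ω^p+q nq)

x≤x⊕y : ∀ x y → x ≤ₒ (x ⊕ y)
x≤x⊕y 𝟎 y = 𝟎≤ₒ y
x≤x⊕y (ω^ a + b) 𝟎 = inj₂ refl
x≤x⊕y (ω^ a + b) (ω^ c + d) with cmp a c | cmp-view a c
... | lt | lt a<c = inj₁ (<hd a<c)
... | eq | _ = ω^+-monoʳ-≤ₒ (x≤x⊕y b (ω^ c + d))
... | gt | _ = ω^+-monoʳ-≤ₒ (x≤x⊕y b (ω^ c + d))

x≤y⊕x : ∀ y x → NF x → x ≤ₒ (y ⊕ x)
x≤y⊕x 𝟎 x _ = inj₂ refl
x≤y⊕x (ω^ g + h) x nx = x≤insω (x≤y⊕x h) x nx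
  where
  x≤insω : (∀ x → NF x → x ≤ₒ (h ⊕ x)) → ∀ x → NF x → x ≤ₒ ((ω^ g + h) ⊕ x)
  x≤insω ih 𝟎 _ = inj₁ <𝟎
  x≤insω ih (ω^ p + q) nx with cmp g p | cmp-view g p
  ... | lt | _ = ω^+-monoʳ-≤ₒ (x≤insω ih q (NF-tail nx))
  ... | eq | eq refl = ω^+-monoʳ-≤ₒ (inj₁ (<-≤ₒ-trans (q<ω^p+q nx) (ih (ω^ g + q) nx)))
  ... | gt | gt p<g = inj₁ (<hd p<g)

ω^+-mono-≤ₒ : ∀ {c d e M} → c ≤ₒ e → d ≤ₒ M → (ω^ c + d) ≤ₒ (ω^ e + M)
ω^+-mono-≤ₒ (inj₁ c<e) _ = inj₁ (<hd c<e)
ω^+-mono-≤ₒ (inj₂ refl) d≤M = ω^+-monoʳ-≤ₒ d≤M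

ω^+≤ω^⊕ : ∀ {c d e} M → c ≤ₒ e → d ≤ₒ M → (ω^ c + d) ≤ₒ ((ω^ e + 𝟎) ⊕ M)
ω^+≤ω^⊕ 𝟎 c≤e d≤𝟎 = ω^+-mono-≤ₒ c≤e d≤𝟎
ω^+≤ω^⊕ {e = e} (ω^ g + h) c≤e d≤M with cmp e g | cmp-view e g
... | lt | lt e<g = inj₁ (<hd (≤-<ₒ-trans c≤e e<g))
... | eq | _ = ω^+-mono-≤ₒ c≤e d≤M
... | gt | _ = ω^+-mono-≤ₒ c≤e d≤M

x≤mulω : ∀ a x → NF x → x ≤ₒ mulω a x
x≤mulω a 𝟎 _ = inj₂ refl
x≤mulω a (ω^ c + d) nx =
  ω^+≤ω^⊕ (mulω a d) (x≤y⊕x a c (NF-head nx)) (x≤mulω a d (NF-tail nx))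

data Positive : Ord → Set where
  positive : ∀ {a b} → Positive (ω^ a + b)

x≤y⊗x : ∀ {y} x → Positive y → NF x → x ≤ₒ (y ⊗ x)
x≤y⊗x {ω^ a + b} x positive nx = ≤ₒ-trans (x≤mulω a x nx) (x≤x⊕y (mulω a x) (b ⊗ x))

⊕-positiveˡ : ∀ {x} y → Positive x → Positive (x ⊕ y)
⊕-positiveˡ 𝟎 positive = positive
⊕-positiveˡ {ω^ a + _} (ω^ c + _) positive with cmp a c
... | lt = positive
... | eq = positive
... | gt = positive

mulω-positive : ∀ a {y} → Positive y → Positive (mulω a y)
mulω-positive a {ω^ _ + d} positive = ⊕-positiveˡ (mulω a d) positive

fromℕ-positive : ∀ n .{{_ : NonZero n}} → Positive (fromℕ n)
fromℕ-positive (suc _) = positive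

pow2-positive : ∀ α → Positive (pow2 α)
pow2-positive α = ⊕-positiveˡ 𝟎 (mulω-positive (divω α) (fromℕ-positive (2 ^ k) {{m^n≢0 2 k}}))
  where k = finPart α

finPart-ω^+ : ∀ c t → finPart (ω^ c + t) ≡ finPart (ω^ c + 𝟎) + finPart t
finPart-ω^+ 𝟎 t = refl
finPart-ω^+ (ω^ _ + _) t = refl

finPart-⊕ : ∀ x y → finPart (x ⊕ y) ≡ finPart x + finPart y
finPart-⊕ 𝟎 y = refl
finPart-⊕ (ω^ a + b) = finPart-insω
  where
  open Relation.Binary.PropositionalEquality.≡-Reasoning
  x = ω^ a + b
  u = finPart (ω^ a + 𝟎)

  finPart-ω^a+ : ∀ y → finPart (ω^ a + (b ⊕ y)) ≡ finPart x + finPart y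
  finPart-ω^a+ y = begin
    finPart (ω^ a + (b ⊕ y))         ≡⟨ finPart-ω^+ a (b ⊕ y) ⟩
    u + finPart (b ⊕ y)              ≡⟨ cong (u +_) (finPart-⊕ b y) ⟩
    u + (finPart b + finPart y)      ≡⟨ sym (+-assoc u (finPart b) (finPart y)) ⟩
    (u + finPart b) + finPart y      ≡⟨ cong (_+ finPart y) (sym (finPart-ω^+ a b)) ⟩
    finPart x + finPart y            ∎

  finPart-insω : ∀ y → finPart (x ⊕ y) ≡ finPart x + finPart y
  finPart-insω 𝟎 = sym (+-identityʳ (finPart x))
  finPart-insω (ω^ c + d) with cmp a c
  ... | eq = finPart-ω^a+ (ω^ c + d)
  ... | gt = finPart-ω^a+ (ω^ c + d)
  ... | lt = begin
    finPart (ω^ c + (x ⊕ d))         ≡⟨ finPart-ω^+ c (x ⊕ d) ⟩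
    v + finPart (x ⊕ d)              ≡⟨ cong (v +_) (finPart-insω d) ⟩
    v + (finPart x + finPart d)      ≡⟨ x∙yz≈y∙xz v (finPart x) (finPart d) ⟩
    finPart x + (v + finPart d)      ≡⟨ cong (finPart x +_) (sym (finPart-ω^+ c d)) ⟩
    finPart x + finPart (ω^ c + d)   ∎
    where v = finPart (ω^ c + 𝟎)

finPart-fromℕ : ∀ n → finPart (fromℕ n) ≡ n
finPart-fromℕ zero = refl
finPart-fromℕ (suc n) = cong suc (finPart-fromℕ n)

fromℕ-mono-≤ₒ : ∀ {p q} → p ≤ q → fromℕ p ≤ₒ fromℕ q
fromℕ-mono-≤ₒ {zero} _ = 𝟎≤ₒ _
fromℕ-mono-≤ₒ (s≤s p≤q) = ω^+-monoʳ-≤ₒ (fromℕ-mono-≤ₒ p≤q)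

fromℕ-⊕ : ∀ p q → fromℕ p ⊕ fromℕ q ≡ fromℕ (p + q)
fromℕ-⊕ zero q = refl
fromℕ-⊕ (suc p) zero = cong (λ k → fromℕ (suc k)) (sym (+-identityʳ p))
fromℕ-⊕ (suc p) (suc q) = cong (ω^ 𝟎 +_) (fromℕ-⊕ p (suc q))

Natural : Ord → Set
Natural x = ∃[ p ] x ≡ fromℕ p

natural-⊕ : ∀ {x y} → Natural x → Natural y → Natural (x ⊕ y)
natural-⊕ (p , refl) (q , refl) = p + q , fromℕ-⊕ p q

-- ψ dominates the finite part

-- Deletes one summand ω^0, so on a normal form with positive finite part it
-- is the predecessor.
predecessor : Ord → Ord
predecessor 𝟎 = 𝟎
predecessor (ω^ 𝟎 + b) = b
predecessor (ω^ (ω^ g + h) + b) = ω^ (ω^ g + h) + predecessor b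

finPart-predecessor : ∀ γ {j} → finPart γ ≡ suc j → finPart (predecessor γ) ≡ j
finPart-predecessor (ω^ 𝟎 + b) fγ = suc-injective fγ
finPart-predecessor (ω^ (ω^ _ + _) + b) fγ = finPart-predecessor b fγ

predecessor-< : ∀ γ {j} → NF γ → finPart γ ≡ suc j → predecessor γ <ₒ γ
predecessor-< (ω^ 𝟎 + b) nγ _ = q<ω^p+q nγ
predecessor-< (ω^ (ω^ _ + _) + b) nγ fγ = <tl (predecessor-< b (NF-tail nγ) fγ)

leadExp≤-predecessor : ∀ {e} b → LeadExp≤ e b → NF b → LeadExp≤ e (predecessor b)
leadExp≤-predecessor 𝟎 _ _ = tt
leadExp≤-predecessor (ω^ 𝟎 + d) 𝟎≤e nb = leadExp≤-weaken d (NF-leadExp nb) 𝟎≤e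
leadExp≤-predecessor (ω^ (ω^ _ + _) + d) c≤e _ = c≤e

predecessor-NF : ∀ γ {j} → NF γ → finPart γ ≡ suc j → NF (predecessor γ)
predecessor-NF (ω^ 𝟎 + b) nγ _ = NF-tail nγ
predecessor-NF (ω^ (ω^ _ + _) + b) nγ fγ =
  NF-ω^+ (NF-head nγ) (predecessor-NF b (NF-tail nγ) fγ)
    (leadExp≤-predecessor b (NF-leadExp nγ) (NF-tail nγ))

no-predecessor : ∀ γ → no (predecessor γ) ≤ no γ
no-predecessor 𝟎 = z≤n
no-predecessor (ω^ 𝟎 + b) = n≤1+n _
no-predecessor (ω^ c@(ω^ _ + _) + b) = s≤s (+-monoʳ-≤ (no c) (no-predecessor b))

n≤2^n : ∀ n → n ≤ 2 ^ n
n≤2^n zero = z≤n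
n≤2^n (suc n) = +-mono-≤ (m^n>0 2 n) (≤-trans (n≤2^n n) (m≤m+n _ 0))

n≤iter : ∀ {f} → (∀ x → x ≤ f x) → ∀ k x → x ≤ iter f k x
n≤iter f-infl zero x = ≤-refl
n≤iter f-infl (suc k) x = ≤-trans (n≤iter f-infl k x) (f-infl _)

n≤F : ∀ j x → x ≤ F j x
n≤F zero x = n≤2^n x
n≤F (suc j) x = n≤iter (n≤F j) (suc x) x

n≤Φ : ∀ n → n ≤ Φ n
n≤Φ n = ≤-trans (m≤m+n n 100) (n≤F 5 (n + 100))

finPart≤ψ : ∀ {ψ} → IsPsi ψ → ∀ γ → NF γ → finPart γ ≤ ψ γ
finPart≤ψ {ψ} isψ γ nγ = descend (finPart γ) γ nγ refl
  where
  descend : ∀ j γ → NF γ → finPart γ ≡ j → j ≤ ψ γ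
  descend zero _ _ _ = z≤n
  descend (suc j) γ nγ fγ =
    ≤-trans (s≤s (descend j γ′ nγ′ (finPart-predecessor γ fγ)))
            (proj₁ (isψ γ nγ) γ′ nγ′ (predecessor-< γ nγ fγ)
                   (≤-trans (no-predecessor γ) (n≤Φ (no γ))))
    where
    γ′ = predecessor γ
    nγ′ = predecessor-NF γ nγ fγ

natural≤ψ : ∀ {ψ} → IsPsi ψ → ∀ {x} y z → Natural x → NF (z ⊕ (x ⊕ y)) →
            x ≤ₒ fromℕ (ψ (z ⊕ (x ⊕ y)))
natural≤ψ isψ {x} y z (r , refl) nα = fromℕ-mono-≤ₒ (begin
  r                            ≡⟨ sym (finPart-fromℕ r) ⟩
  finPart x                    ≤⟨ m≤m+n (finPart x) (finPart y) ⟩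
  finPart x + finPart y        ≡⟨ sym (finPart-⊕ x y) ⟩
  finPart (x ⊕ y)              ≤⟨ m≤n+m _ (finPart z) ⟩
  finPart z + finPart (x ⊕ y)  ≡⟨ sym (finPart-⊕ z (x ⊕ y)) ⟩
  finPart (z ⊕ (x ⊕ y))        ≤⟨ finPart≤ψ isψ _ nα ⟩
  _                            ∎)
  where open Data.Nat.Properties.≤-Reasoning

-- Level-0 terms denote natural numbers

B₀-natural : ∀ {ψ t} → B ψ 0 t → Natural (⟦ t ⟧c ψ)
B₀-natural b1 = 1 , refl
B₀-natural (b+ f g) = natural-⊕ (B₀-natural f) (B₀-natural g)
B₀-natural (bψ _ _ _) = _ , refl
B₀-natural (b0 f) = B₀-natural f

C₀-natural : ∀ {ψ lv χ t} → Admissible ψ lv χ → C ψ lv 0 t → Natural (⟦ t ⟧ ψ (envOf ψ χ))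
C₀-natural adm c1 = 1 , refl
C₀-natural adm (cvar {v} _) = B₀-natural (proj₁ adm v 0 z≤n)
C₀-natural adm (c+ f g) = natural-⊕ (C₀-natural adm f) (C₀-natural adm g)
C₀-natural adm (cψ _ _ _) = _ , refl
C₀-natural adm (c0 f) = C₀-natural adm f

get-above : ∀ {n} (v : Vec Term (suc n)) {i} → n < i → get v i ≡ zer
get-above {n} v {i} n<i with i ≤? n
... | yes i≤n = contradiction i≤n (<⇒≱ n<i)
... | no′ _ = refl

get-InC : ∀ {ψ lv n} {v : Vec Term (suc n)} → InC ψ lv v → ∀ {i} → i ≤ n → C ψ lv i (get v i)
get-InC {ψ} {lv} {n} {v} v∈C {i} i≤n with i ≤? n
... | yes p = subst (λ k → C ψ lv k (lookup v (fromℕ< (s≤s p)))) (toℕ-fromℕ< (s≤s p))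
                    (v∈C (fromℕ< (s≤s p)))
... | no′ i≰n = contradiction i≤n i≰n

get-box : ∀ {m n} (a : Vec Term (suc m)) (b : Vec Term (suc n)) {i} → i ≤ m →
          get (box a b) i ≡ boxAux a b i (m ∸ i)
get-box {m} a b {i} i≤m with i ≤? m
... | yes p = trans (lookup∘tabulate (λ j → boxAux a b (toℕ j) (m ∸ toℕ j)) (fromℕ< (s≤s p)))
                    (cong (λ j → boxAux a b j (m ∸ j)) (toℕ-fromℕ< (s≤s p)))
... | no′ i≰m = contradiction i≤m i≰m

boxAux-above : ∀ {m n} (a : Vec Term (suc m)) (b : Vec Term (suc n)) {i} k → n < i →
               boxAux a b i k ≡ get a i
boxAux-above a b zero _ = refl
boxAux-above {n = n} a b {suc i} (suc k) n<i with n <? suc i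
... | yes _ = refl
... | no′ n≮i = contradiction n<i n≮i

boxAux-below : ∀ {m n} (a : Vec Term (suc m)) (b : Vec Term (suc n)) {i} k → suc i ≤ n →
               boxAux a b (suc i) (suc k)
                 ≡ twoPow (boxAux a b (suc (suc i)) k) (plus (get a (suc i)) (get b (suc i)))
boxAux-below {n = n} a b {i} k i<n with n <? suc i
... | yes n<i = contradiction i<n (<⇒≱ n<i)
... | no′ _ = refl

m∸n≡1+m∸1+n : ∀ {m n} → n < m → m ∸ n ≡ suc (m ∸ suc n)
m∸n≡1+m∸1+n {suc m} {zero} _ = refl
m∸n≡1+m∸1+n {suc m} {suc n} (s≤s n<m) = m∸n≡1+m∸1+n n<m

box-dominates-below : ∀ {ψ} → IsPsi ψ → ∀ {lv χ} → Admissible ψ lv χ →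
  ∀ {m n} (a : Vec Term (suc m)) (b : Vec Term (suc n)) → InC ψ lv a → InC ψ lv b →
  ∀ i k → i ≤ n →
  ⟦ plus (get a i) (get b i) ⟧ ψ (envOf ψ χ) ≤ₒ ⟦ boxAux a b i (suc k) ⟧ ψ (envOf ψ χ)
box-dominates-below {ψ} isψ {χ = χ} adm {n = n} a b a∈C b∈C zero k _ =
  natural≤ψ isψ (⟦ num n ⟧ ψ ρ) (ω ⊗ ⟦ boxAux a b 1 k ⟧ ψ ρ)
    (C₀-natural adm (c+ (get-InC {v = a} a∈C z≤n) (get-InC {v = b} b∈C z≤n)))
    (⊕-NF _ _ (⊗-NF _ _ ω-NF (NF-⟦_⟧ (boxAux a b 1 k)))
              (NF-⟦_⟧ (plus (plus (get a 0) (get b 0)) (num n))))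
  where
  ρ = envOf ψ χ
  NF-⟦_⟧ : ∀ t → NF (⟦ t ⟧ ψ ρ)
  NF-⟦_⟧ = ⟦⟧-NF (envOf-NF ψ χ)
box-dominates-below {ψ} isψ {χ = χ} adm a b a∈C b∈C (suc i) k i<n
  rewrite boxAux-below a b k i<n =
  x≤y⊗x _ (pow2-positive (⟦ boxAux a b (suc (suc i)) k ⟧ ψ (envOf ψ χ)))
          (⟦⟧-NF (envOf-NF ψ χ) (plus (get a (suc i)) (get b (suc i))))

lemma2p13 : (ψ : Ord → ℕ) → IsPsi ψ → (lv : ℕ → ℕ) →
    ∀ {m n} (a : Vec Term (suc m)) (b : Vec Term (suc n)) →
    InC ψ lv a → InC ψ lv b → n < m →
    ∀ i → i ≤ m → (ψ , lv) ⊢ plus (get a i) (get b i) ≼ get (box a b) i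
lemma2p13 ψ isψ lv {m} {n} a b a∈C b∈C n<m i i≤m χ adm
  rewrite get-box a b i≤m with n <? i
... | yes n<i rewrite boxAux-above a b (m ∸ i) n<i | get-above b n<i =
  inj₂ (⊕-identityʳ _)
... | no′ n≮i rewrite m∸n≡1+m∸1+n (≤-<-trans (≮⇒≥ n≮i) n<m) =
  box-dominates-below isψ adm a b a∈C b∈C i (m ∸ suc i) (≮⇒≥ n≮i)
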